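{- Let $G$ be a $K_4$-free graph and let $u\in V(G)$ and $B\subseteq V(G)\setminus\{u\}$ with $|B|=4$. If $G[B]$ induces a copy of $K_4^-$ ($K_4$ minus one edge), then ${\rm ext}_G(u,B)\leq 5$.
   Context: All graphs are finite and simple. An orientation is $K^\circlearrowright_3$-free if it contains no cyclically oriented triangle. For a graph $G$, $\mathcal{D}(G)$ denotes the set of $K^\circlearrowright_3$-free orientations of $G$. Orientations $\vec S,\vec T$ of disjoint edge sets are compatible if $\vec S\cup\vec T$ is $K^\circlearrowright_3$-free. For disjoint $A,B\subseteq V(G)$, $G[A,B]$ denotes the graph with the edges of $G$ between $A$ and $B$, and with $T=G[A]\cup G[B]$, ${\rm ext}_G(A,B)=\max_{\vec T\in\mathcal{D}(T)}|\{\vec S\in\mathcal{D}(G[A,B])\colon \vec S\text{ and }\vec T\text{ compatible}\}|$; ${\rm ext}_G(u,B)$ means ${\rm ext}_G(\{u\},B)$. -}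

module Defs where

open import Data.Bool using (Bool; true; false; _∧_; _∨_)
open import Data.Bool.Properties using () renaming (_≟_ to _≟ᵇ_)
open import Data.Nat using (ℕ; _⊔_)
open import Data.Fin using (Fin)
open import Data.Fin.Properties using (any?; all?)
open import Data.Fin.Subset using (Subset)
open import Data.Vec using (Vec; []; _∷_; lookup; zipWith)
open import Data.List using (List; []; _∷_; _++_; map; concatMap; filter; length; foldr)
open import Data.Product using (_×_; ∃; _,_)
open import Data.Empty using (⊥)
open import Data.Sum using (_⊎_)
open import Relation.Nullary using (¬_; Dec)
open import Relation.Nullary.Decidable using (¬?; _×-dec_)
open import Relation.Binary.PropositionalEquality using (_≡_)

record Graph (n : ℕ) : Set where
  field
    adj   : Fin n → Fin n → Bool
    sym   : ∀ x y → adj x y ≡ adj y x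
    irrefl : ∀ x → adj x x ≡ false
open Graph public

-- K4-free: no four pairwise adjacent vertices (distinctness follows from
-- irreflexivity).
K4-free : ∀ {n} → Graph n → Set
K4-free G = ∀ a b c d → adj G a b ≡ true → adj G a c ≡ true → adj G a d ≡ true
  → adj G b c ≡ true → adj G b d ≡ true → adj G c d ≡ true → ⊥

EdgeSet : ℕ → Set
EdgeSet n = Fin n → Fin n → Bool

crossEdges : ∀ {n} → Graph n → Subset n → Subset n → EdgeSet n
crossEdges G A B x y =
  adj G x y ∧ ((lookup A x ∧ lookup B y) ∨ (lookup B x ∧ lookup A y))

insideEdges : ∀ {n} → Graph n → Subset n → Subset n → EdgeSet n
insideEdges G A B x y =
  adj G x y ∧ ((lookup A x ∧ lookup A y) ∨ (lookup B x ∧ lookup B y))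

-- A (candidate) orientation: arc relation stored as an n×n Boolean matrix;
-- M[x][y] = true means the arc x → y is present.
Orient : ℕ → Set
Orient n = Vec (Vec Bool n) n

arc : ∀ {n} → Orient n → Fin n → Fin n → Bool
arc M x y = lookup (lookup M x) y

IsOrientation : ∀ {n} → EdgeSet n → Orient n → Set
IsOrientation e M = ∀ x y → (e x y ≡ (arc M x y ∨ arc M y x)) × ((arc M x y ∧ arc M y x) ≡ false)

isOrientation? : ∀ {n} (e : EdgeSet n) (M : Orient n) → Dec (IsOrientation e M)
isOrientation? e M = all? λ x → all? λ y →
  (e x y ≟ᵇ (arc M x y ∨ arc M y x)) ×-dec ((arc M x y ∧ arc M y x) ≟ᵇ false)

CyclicTriangle : ∀ {n} → Orient n → Set
CyclicTriangle M = ∃ λ x → ∃ λ y → ∃ λ z →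
  (arc M x y ≡ true) × (arc M y z ≡ true) × (arc M z x ≡ true)

K3cyc-free : ∀ {n} → Orient n → Set
K3cyc-free M = ¬ CyclicTriangle M

K3cyc-free? : ∀ {n} (M : Orient n) → Dec (K3cyc-free M)
K3cyc-free? M = ¬? (any? λ x → any? λ y → any? λ z →
  (arc M x y ≟ᵇ true) ×-dec (arc M y z ≟ᵇ true) ×-dec (arc M z x ≟ᵇ true))

_∪ₒ_ : ∀ {n} → Orient n → Orient n → Orient n
M ∪ₒ N = zipWith (zipWith _∨_) M N

Compatible : ∀ {n} → Orient n → Orient n → Set
Compatible S T = K3cyc-free (S ∪ₒ T)

allVecs : ∀ {a} {A : Set a} → List A → (m : ℕ) → List (Vec A m)
allVecs xs ℕ.zero = [] ∷ []
allVecs xs (ℕ.suc m) = concatMap (λ x → map (x ∷_) (allVecs xs m)) xs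

allOrient : (n : ℕ) → List (Orient n)
allOrient n = allVecs (allVecs (true ∷ false ∷ []) n) n

-- 𝒟(e): the list of all K3-cyclic-free orientations of the edge set e
-- (each orientation appears exactly once).
𝒟 : ∀ {n} → EdgeSet n → List (Orient n)
𝒟 {n} e = filter (λ M → isOrientation? e M ×-dec K3cyc-free? M) (allOrient n)

ext : ∀ {n} → Graph n → Subset n → Subset n → ℕ
ext G A B = foldr _⊔_ 0
  (map (λ T → length (filter (λ S → K3cyc-free? (S ∪ₒ T)) (𝒟 (crossEdges G A B))))
       (𝒟 (insideEdges G A B)))

InducesK4⁻ : ∀ {n} → Graph n → Subset n → Set
InducesK4⁻ {n} G B = ∃ λ a → ∃ λ b → ∃ λ c → ∃ λ d →
  (¬ a ≡ b) × (¬ a ≡ c) × (¬ a ≡ d) × (¬ b ≡ c) × (¬ b ≡ d) × (¬ c ≡ d) ×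
  (∀ x → lookup B x ≡ true → (x ≡ a) ⊎ (x ≡ b) ⊎ (x ≡ c) ⊎ (x ≡ d)) ×
  (lookup B a ≡ true) × (lookup B b ≡ true) × (lookup B c ≡ true) × (lookup B d ≡ true) ×
  (adj G a b ≡ true) × (adj G a c ≡ true) × (adj G a d ≡ true) ×
  (adj G b c ≡ true) × (adj G b d ≡ true) × (adj G c d ≡ false)

module Submission where

-- Fix T ∈ 𝒟(G[{u}] ∪ G[B]).  Every edge of G[{u},B] contains u, so an
-- orientation S of it is determined by its signature: which of a,b,c,d the
-- vertex u points to (at most 2⁴ possibilities).  If S is compatible with T,
-- the signature only uses neighbours of u and creates no cyclic triangle
-- u x y over any of the five edges xy of the K4⁻; call such a signature
-- admissible.  Since G is K4-free, u is not joined to all of the triangle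
-- abc, nor to all of abd, and an exhaustive computation over the 2⁴ · 2⁵
-- possible neighbourhoods of u and orientations of the five edges shows that
-- then at most 5 signatures are admissible.  Hence every T has at most 5
-- compatible S, and so does the maximum ext_G({u},B).

open import Defs hiding (sym)
open import Data.Nat using (ℕ; _≤_; zero; suc; z≤n; s≤s; _≤ᵇ_)
open import Data.Nat.Properties using (⊔-lub; ≤ᵇ⇒≤; module ≤-Reasoning)
open import Data.Fin using (Fin)
open import Data.Fin.Subset using (Subset; ⁅_⁆; _∉_; ∣_∣)
open import Data.Fin.Subset.Properties using (x∈⁅x⁆; x∈⁅y⁆⇒x≡y)
open import Data.Bool using (Bool; true; false; _∧_; _∨_; not; T; T?)
open import Data.Bool.Properties using (T-≡; ∧-zeroʳ; ∧-identityʳ; ∨-zeroʳ; ∨-identityʳ; ∨-conicalˡ)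
open import Data.Vec using (Vec; []; _∷_; lookup; zipWith)
open import Data.Vec.Properties using (lookup-zipWith; lookup⇒[]=; []=⇒lookup; ∷-injective; tabulate∘lookup; tabulate-cong)
open import Data.List using (List; []; _∷_; _++_; map; concatMap; filter; filterᵇ; length; cartesianProductWith)
open import Data.List.Properties using (length-map; length-removeAt′; foldr-preservesᵇ)
open import Data.List.Membership.Propositional using (_∈_)
open import Data.List.Membership.Propositional.Properties using (∈-map⁻; ∈-filter⁺; ∈-filter⁻; ∈-cartesianProductWith⁺)
open import Data.List.Relation.Binary.Subset.Propositional using (_⊆_)
open import Data.List.Relation.Unary.Any using (here; there; index; _─_)
open import Data.List.Relation.Unary.All as All using (All; []; _∷_; all?)
import Data.List.Relation.Unary.All.Properties as AllP
open import Data.List.Relation.Unary.Unique.Propositional using (Unique; []; _∷_)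
open import Data.List.Relation.Unary.Unique.Propositional.Properties using (filter⁺; cartesianProductWith⁺)
open import Data.Product using (_×_; _,_; proj₁; proj₂)
open import Data.Sum using (_⊎_; inj₁; inj₂)
open import Data.Empty using (⊥; ⊥-elim)
open import Function.Bundles using (module Equivalence)
open import Relation.Nullary using (contradiction)
open import Relation.Nullary.Decidable using (toWitness; _×-dec_)
open import Relation.Binary.PropositionalEquality using (_≡_; _≢_; refl; sym; trans; cong; subst)

∈-─ : ∀ {A : Set} {x y : A} {ys : List A} (x∈ys : x ∈ ys) → y ∈ ys → y ≢ x → y ∈ (ys ─ x∈ys)
∈-─ (here refl)  (here refl)  y≢x = ⊥-elim (y≢x refl)
∈-─ (here _)     (there y∈ys) _   = y∈ys
∈-─ (there _)    (here y≡z)   _   = here y≡z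
∈-─ (there x∈ys) (there y∈ys) y≢x = there (∈-─ x∈ys y∈ys y≢x)

unique-⊆-length : ∀ {A : Set} {xs ys : List A} → Unique xs → xs ⊆ ys → length xs ≤ length ys
unique-⊆-length {xs = []}     []            _     = z≤n
unique-⊆-length {xs = x ∷ xs} {ys} (x∉xs ∷ xs!) xs⊆ys = begin
  suc (length xs)          ≤⟨ s≤s (unique-⊆-length xs! xs⊆ys─x) ⟩
  suc (length (ys ─ x∈ys)) ≡⟨ sym (length-removeAt′ ys (index x∈ys)) ⟩
  length ys                ∎
  where
  open ≤-Reasoning
  x∈ys : x ∈ ys
  x∈ys = xs⊆ys (here refl)
  xs⊆ys─x : xs ⊆ (ys ─ x∈ys)
  xs⊆ys─x y∈xs = ∈-─ x∈ys (xs⊆ys (there y∈xs)) (λ y≡x → All.lookup x∉xs y∈xs (sym y≡x))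

map-unique : ∀ {A B : Set} (f : A → B) {xs : List A} →
  (∀ {x y} → x ∈ xs → y ∈ xs → f x ≡ f y → x ≡ y) → Unique xs → Unique (map f xs)
map-unique f {[]}     inj []           = []
map-unique f {x ∷ xs} inj (x∉xs ∷ xs!) =
  AllP.map⁺ (All.tabulate λ y∈xs fx≡fy → All.lookup x∉xs y∈xs (inj (here refl) (there y∈xs) fx≡fy))
  ∷ map-unique f (λ x∈ y∈ → inj (there x∈) (there y∈)) xs!

-- Each layer of allVecs is a cartesian product, which puts the library's
-- facts about cartesianProductWith at our disposal.
allVecs-suc : ∀ {A : Set} (xs : List A) (m : ℕ) →
  allVecs xs (suc m) ≡ cartesianProductWith _∷_ xs (allVecs xs m)
allVecs-suc xs m = layers xs
  where
  layers : ∀ ys → concatMap (λ y → map (y ∷_) (allVecs xs m)) ys ≡ cartesianProductWith _∷_ ys (allVecs xs m)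
  layers []       = refl
  layers (y ∷ ys) = cong (map (y ∷_) (allVecs xs m) ++_) (layers ys)

-- Enumerating vectors over a duplicate-free list produces no duplicates; this
-- is what makes the lengths in ext count orientations.
allVecs-unique : ∀ {A : Set} {xs : List A} → Unique xs → ∀ m → Unique (allVecs xs m)
allVecs-unique xs! zero = [] ∷ []
allVecs-unique {xs = xs} xs! (suc m) =
  subst Unique (sym (allVecs-suc xs m)) (cartesianProductWith⁺ _∷_ ∷-injective xs! (allVecs-unique xs! m))

allVecs-complete : ∀ {A : Set} {xs : List A} → (∀ x → x ∈ xs) → ∀ {m} (v : Vec A m) → v ∈ allVecs xs m
allVecs-complete all∈ [] = here refl
allVecs-complete {xs = xs} all∈ {suc m} (x ∷ v) =
  subst (x ∷ v ∈_) (sym (allVecs-suc xs m)) (∈-cartesianProductWith⁺ _∷_ (all∈ x) (allVecs-complete all∈ v))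

bools : List Bool
bools = true ∷ false ∷ []

bools-unique : Unique bools
bools-unique = ((λ ()) ∷ []) ∷ [] ∷ []

bools-complete : ∀ x → x ∈ bools
bools-complete true  = here refl
bools-complete false = there (here refl)

allOrient-unique : ∀ n → Unique (allOrient n)
allOrient-unique n = allVecs-unique (allVecs-unique bools-unique n) n

module Orientations {n : ℕ} {e : EdgeSet n} where

  orient-ext : ∀ {S S' : Orient n} → (∀ x y → arc S x y ≡ arc S' x y) → S ≡ S'
  orient-ext {S} {S'} same = rows (λ x → rows (same x))
    where
    rows : ∀ {A : Set} {m} {v w : Vec A m} → (∀ i → lookup v i ≡ lookup w i) → v ≡ w
    rows {v = v} {w} same-at =
      trans (sym (tabulate∘lookup v)) (trans (tabulate-cong same-at) (tabulate∘lookup w))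

  arc-absent : ∀ S {x y} → IsOrientation e S → e x y ≡ false → arc S x y ≡ false
  arc-absent S {x} {y} O exy = ∨-conicalˡ _ (arc S y x) (trans (sym (proj₁ (O x y))) exy)

  arc⇒edge : ∀ S {x y} → IsOrientation e S → arc S x y ≡ true → e x y ≡ true
  arc⇒edge S {x} {y} O xy = trans (proj₁ (O x y)) (cong (_∨ arc S y x) xy)

  arc-reverse : ∀ S {x y} → IsOrientation e S → e x y ≡ true → arc S x y ≡ false → arc S y x ≡ true
  arc-reverse S {x} {y} O exy ¬xy =
    trans (sym (subst (λ k → e x y ≡ (k ∨ arc S y x)) ¬xy (proj₁ (O x y)))) exy

  reverse-agree : ∀ S S' {x y} → IsOrientation e S → IsOrientation e S' →
    arc S x y ≡ arc S' x y → arc S y x ≡ arc S' y x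
  reverse-agree S S' {x} {y} O O' same =
    other-determined same (proj₁ (O x y)) (proj₁ (O' x y)) (proj₂ (O x y)) (proj₂ (O' x y))
    where
    other-determined : ∀ {p q p' q'} → p ≡ p' → e x y ≡ (p ∨ q) → e x y ≡ (p' ∨ q') →
      (p ∧ q) ≡ false → (p' ∧ q') ≡ false → q ≡ q'
    other-determined {true}  refl _   _    excl excl' = trans excl (sym excl')
    other-determined {false} refl exy exy' _    _     = trans (sym exy) exy'

  star-determined : ∀ {u S S'} → (∀ {x y} → e x y ≡ true → x ≡ u ⊎ y ≡ u) →
    IsOrientation e S → IsOrientation e S' → (∀ y → arc S u y ≡ arc S' u y) → S ≡ S'
  star-determined {u} {S} {S'} star O O' out = orient-ext agree
    where
    agree : ∀ x y → arc S x y ≡ arc S' x y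
    agree x y with e x y in exy
    ... | false = trans (arc-absent S O exy) (sym (arc-absent S' O' exy))
    ... | true with star exy
    ...   | inj₁ refl = out y
    ...   | inj₂ refl = reverse-agree S S' O O' (out x)

open Orientations

arc-∪ : ∀ {n} (S T : Orient n) x y → arc (S ∪ₒ T) x y ≡ (arc S x y ∨ arc T x y)
arc-∪ S T x y = trans (cong (λ row → lookup row y) (lookup-zipWith (zipWith _∨_) x S T))
                      (lookup-zipWith _∨_ y (lookup S x) (lookup T x))

∪-inl : ∀ {n} (S T : Orient n) {x y} → arc S x y ≡ true → arc (S ∪ₒ T) x y ≡ true
∪-inl S T {x} {y} xy = trans (arc-∪ S T x y) (cong (_∨ arc T x y) xy)

∪-inr : ∀ {n} (S T : Orient n) {x y} → arc T x y ≡ true → arc (S ∪ₒ T) x y ≡ true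
∪-inr S T {x} {y} xy = trans (arc-∪ S T x y) (trans (cong (arc S x y ∨_) xy) (∨-zeroʳ _))

-- acyclicTriangle ex ey kx ky txy: in a triangle u x y whose edges ux, uy are
-- present iff ex, ey, with u → x iff kx, u → y iff ky and x → y iff txy, the
-- orientation is not cyclic (neither u→x→y→u nor u→y→x→u).
acyclicTriangle : (ex ey kx ky txy : Bool) → Bool
acyclicTriangle ex ey kx ky txy = not (ex ∧ ey ∧ ((kx ∧ txy ∧ not ky) ∨ (ky ∧ not txy ∧ not kx)))

acyclic-intro : ∀ ex ey kx ky txy →
  (ex ≡ true → ey ≡ true → kx ≡ true → txy ≡ true → ky ≡ false → ⊥) →
  (ex ≡ true → ey ≡ true → ky ≡ true → txy ≡ false → kx ≡ false → ⊥) →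
  acyclicTriangle ex ey kx ky txy ≡ true
acyclic-intro false _     _     _     _     _   _   = refl
acyclic-intro true  false _     _     _     _   _   = refl
acyclic-intro true  true  true  true  true  _   _   = refl
acyclic-intro true  true  true  true  false _   _   = refl
acyclic-intro true  true  false false true  _   _   = refl
acyclic-intro true  true  false false false _   _   = refl
acyclic-intro true  true  true  false true  fwd _   = ⊥-elim (fwd refl refl refl refl refl)
acyclic-intro true  true  true  false false _   _   = refl
acyclic-intro true  true  false true  true  _   _   = refl
acyclic-intro true  true  false true  false _   bwd = ⊥-elim (bwd refl refl refl refl refl)

triangle-acyclic : ∀ {n} {e f : EdgeSet n} (S T : Orient n) {u x y} →
  IsOrientation e S → IsOrientation f T → Compatible S T → f x y ≡ true →
  acyclicTriangle (e u x) (e u y) (arc S u x) (arc S u y) (arc T x y) ≡ true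
triangle-acyclic {e = e} {f} S T {u} {x} {y} OS OT free fxy = acyclic-intro _ _ _ _ _ forward backward
  where
  forward : e u x ≡ true → e u y ≡ true → arc S u x ≡ true → arc T x y ≡ true → arc S u y ≡ false → ⊥
  forward _ euy ux xy ¬uy =
    free (u , x , y , ∪-inl S T ux , ∪-inr S T xy , ∪-inl S T (arc-reverse S OS euy ¬uy))
  backward : e u x ≡ true → e u y ≡ true → arc S u y ≡ true → arc T x y ≡ false → arc S u x ≡ false → ⊥
  backward eux _ uy ¬xy ¬ux =
    free (u , y , x , ∪-inl S T uy , ∪-inr S T (arc-reverse T OT fxy ¬xy) , ∪-inl S T (arc-reverse S OS eux ¬ux))

-- Admissible N t k: the signature k (u → a, u → b, u → c, u → d) uses only
-- the neighbours N of u among a,b,c,d and makes no cyclic triangle with the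
-- orientation t of the edges ab, ac, ad, bc, bd.
Admissible : Vec Bool 4 → Vec Bool 5 → Vec Bool 4 → Bool
Admissible (na ∷ nb ∷ nc ∷ nd ∷ []) (tab ∷ tac ∷ tad ∷ tbc ∷ tbd ∷ []) (ka ∷ kb ∷ kc ∷ kd ∷ []) =
  (not ka ∨ na) ∧ (not kb ∨ nb) ∧ (not kc ∨ nc) ∧ (not kd ∨ nd) ∧
  acyclicTriangle na nb ka kb tab ∧ acyclicTriangle na nc ka kc tac ∧ acyclicTriangle na nd ka kd tad ∧
  acyclicTriangle nb nc kb kc tbc ∧ acyclicTriangle nb nd kb kd tbd

admissibleCount : Vec Bool 4 → Vec Bool 5 → ℕ
admissibleCount N t = length (filterᵇ (Admissible N t) (allVecs bools 4))

joinedToTriangle : Vec Bool 4 → Bool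
joinedToTriangle (na ∷ nb ∷ nc ∷ nd ∷ []) = (na ∧ nb ∧ nc) ∨ (na ∧ nb ∧ nd)

joinedToTriangle-false : ∀ na nb nc nd →
  (na ≡ true → nb ≡ true → nc ≡ true → ⊥) → (na ≡ true → nb ≡ true → nd ≡ true → ⊥) →
  joinedToTriangle (na ∷ nb ∷ nc ∷ nd ∷ []) ≡ false
joinedToTriangle-false false _     _     _     _    _    = refl
joinedToTriangle-false true  false _     _     _    _    = refl
joinedToTriangle-false true  true  true  _     abc  _    = ⊥-elim (abc refl refl refl)
joinedToTriangle-false true  true  false true  _    abd  = ⊥-elim (abd refl refl refl)
joinedToTriangle-false true  true  false false _    _    = refl

exhaustive : All (λ N → All (λ t → T (joinedToTriangle N ∨ (admissibleCount N t ≤ᵇ 5)))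
                                 (allVecs bools 5))
                 (allVecs bools 4)
exhaustive = toWitness {a? = all? (λ N → all? (λ t → T? (joinedToTriangle N ∨ (admissibleCount N t ≤ᵇ 5)))
                                             (allVecs bools 5))
                                  (allVecs bools 4)} _

admissible-bound : ∀ N t → joinedToTriangle N ≡ false → admissibleCount N t ≤ 5
admissible-bound N t notJoined = ≤ᵇ⇒≤ _ 5
  (subst (λ j → T (j ∨ (admissibleCount N t ≤ᵇ 5))) notJoined
    (All.lookup (All.lookup exhaustive (allVecs-complete bools-complete N)) (allVecs-complete bools-complete t)))

-- Throughout, B ⊆ {a,b,c,d} with u ∉ B and the five edges ab, ac, ad, bc,
-- bd present.

module AtVertex {n : ℕ} (G : Graph n) (u : Fin n) (B : Subset n) (u∉B : lookup B u ≡ false)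
  (a b c d : Fin n) (B⊆abcd : ∀ x → lookup B x ≡ true → (x ≡ a) ⊎ (x ≡ b) ⊎ (x ≡ c) ⊎ (x ≡ d))
  (Ba : lookup B a ≡ true) (Bb : lookup B b ≡ true) (Bc : lookup B c ≡ true) (Bd : lookup B d ≡ true)
  (ab : adj G a b ≡ true) (ac : adj G a c ≡ true) (ad : adj G a d ≡ true)
  (bc : adj G b c ≡ true) (bd : adj G b d ≡ true) where

  cross : EdgeSet n
  cross = crossEdges G ⁅ u ⁆ B

  inside : EdgeSet n
  inside = insideEdges G ⁅ u ⁆ B

  u∈⁅u⁆ : lookup ⁅ u ⁆ u ≡ true
  u∈⁅u⁆ = []=⇒lookup (x∈⁅x⁆ u)

  cross-star : ∀ {x y} → cross x y ≡ true → x ≡ u ⊎ y ≡ u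
  cross-star {x} {y} exy with lookup ⁅ u ⁆ x in ux | lookup ⁅ u ⁆ y in uy
  ... | true  | _    = inj₁ (x∈⁅y⁆⇒x≡y u (lookup⇒[]= x ⁅ u ⁆ ux))
  ... | false | true = inj₂ (x∈⁅y⁆⇒x≡y u (lookup⇒[]= y ⁅ u ⁆ uy))
  ... | false | false with lookup B x
  ...   | true  = contradiction (trans (sym (∧-zeroʳ (adj G x y))) exy) λ ()
  ...   | false = contradiction (trans (sym (∧-zeroʳ (adj G x y))) exy) λ ()

  cross-from-u : ∀ y → cross u y ≡ (adj G u y ∧ lookup B y)
  cross-from-u y rewrite u∈⁅u⁆ | u∉B | ∨-identityʳ (lookup B y) = refl

  cross⇒adj : ∀ {y} → cross u y ≡ true → adj G u y ≡ true
  cross⇒adj {y} uy with adj G u y | trans (sym (cross-from-u y)) uy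
  ... | true | _ = refl

  inside-B : ∀ {x y} → lookup B x ≡ true → lookup B y ≡ true → inside x y ≡ adj G x y
  inside-B {x} {y} Bx By
    rewrite Bx | By | ∨-zeroʳ (lookup ⁅ u ⁆ x ∧ lookup ⁅ u ⁆ y) = ∧-identityʳ (adj G x y)

  signature : Orient n → Vec Bool 4
  signature S = arc S u a ∷ arc S u b ∷ arc S u c ∷ arc S u d ∷ []

  neighbourhood : Vec Bool 4
  neighbourhood = cross u a ∷ cross u b ∷ cross u c ∷ cross u d ∷ []

  edgePattern : Orient n → Vec Bool 5
  edgePattern T = arc T a b ∷ arc T a c ∷ arc T a d ∷ arc T b c ∷ arc T b d ∷ []

  signature-injective : ∀ {S S'} → IsOrientation cross S → IsOrientation cross S' →
    signature S ≡ signature S' → S ≡ S'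
  signature-injective {S} {S'} O O' same = star-determined cross-star O O' out
    where
    at : ∀ (i : Fin 4) → lookup (signature S) i ≡ lookup (signature S') i
    at i = cong (λ v → lookup v i) same
    out : ∀ y → arc S u y ≡ arc S' u y
    out y with lookup B y in By
    ... | false = trans (arc-absent S O no-uy) (sym (arc-absent S' O' no-uy))
      where
      no-uy : cross u y ≡ false
      no-uy = trans (cross-from-u y) (trans (cong (adj G u y ∧_) By) (∧-zeroʳ _))
    ... | true with B⊆abcd y By
    ...   | inj₁ refl                   = at Fin.zero
    ...   | inj₂ (inj₁ refl)            = at (Fin.suc Fin.zero)
    ...   | inj₂ (inj₂ (inj₁ refl))     = at (Fin.suc (Fin.suc Fin.zero))
    ...   | inj₂ (inj₂ (inj₂ refl))     = at (Fin.suc (Fin.suc (Fin.suc Fin.zero)))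

  signature-admissible : ∀ S T → IsOrientation cross S → IsOrientation inside T → Compatible S T →
    Admissible neighbourhood (edgePattern T) (signature S) ≡ true
  signature-admissible S T OS OT free =
    both (along a) (both (along b) (both (along c) (both (along d)
      (both (tri Ba Bb ab) (both (tri Ba Bc ac) (both (tri Ba Bd ad)
      (both (tri Bb Bc bc) (tri Bb Bd bd))))))))
    where
    both : ∀ {p q} → p ≡ true → q ≡ true → (p ∧ q) ≡ true
    both refl q = q
    along : ∀ x → (not (arc S u x) ∨ cross u x) ≡ true
    along x with arc S u x in ux
    ... | true  = arc⇒edge S OS ux
    ... | false = refl
    tri : ∀ {x y} → lookup B x ≡ true → lookup B y ≡ true → adj G x y ≡ true →
      acyclicTriangle (cross u x) (cross u y) (arc S u x) (arc S u y) (arc T x y) ≡ true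
    tri Bx By xy = triangle-acyclic S T OS OT free (trans (inside-B Bx By) xy)

  not-joined : K4-free G → joinedToTriangle neighbourhood ≡ false
  not-joined k4 = joinedToTriangle-false (cross u a) (cross u b) (cross u c) (cross u d)
    (λ ua ub uc → k4 u a b c (cross⇒adj ua) (cross⇒adj ub) (cross⇒adj uc) ab ac bc)
    (λ ua ub ud → k4 u a b d (cross⇒adj ua) (cross⇒adj ub) (cross⇒adj ud) ab ad bd)

  compatibleCount : Orient n → ℕ
  compatibleCount T = length (filter (λ S → K3cyc-free? (S ∪ₒ T)) (𝒟 cross))

  compatible-bound : K4-free G → ∀ {T} → T ∈ 𝒟 inside → compatibleCount T ≤ 5
  compatible-bound k4 {T} T∈𝒟 = begin
    compatibleCount T
      ≡⟨ sym (length-map signature L) ⟩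
    length (map signature L)
      ≤⟨ unique-⊆-length signatures-unique signatures-admissible ⟩
    admissibleCount neighbourhood (edgePattern T)
      ≤⟨ admissible-bound neighbourhood (edgePattern T) (not-joined k4) ⟩
    5 ∎
    where
    open ≤-Reasoning
    OT : IsOrientation inside T
    OT = proj₁ (proj₂ (∈-filter⁻ (λ M → isOrientation? inside M ×-dec K3cyc-free? M) {xs = allOrient n} T∈𝒟))
    L : List (Orient n)
    L = filter (λ S → K3cyc-free? (S ∪ₒ T)) (𝒟 cross)
    member : ∀ {S} → S ∈ L → IsOrientation cross S × Compatible S T
    member S∈L with ∈-filter⁻ (λ S → K3cyc-free? (S ∪ₒ T)) {xs = 𝒟 cross} S∈L
    ... | S∈𝒟 , free = proj₁ (proj₂ (∈-filter⁻ (λ M → isOrientation? cross M ×-dec K3cyc-free? M) {xs = allOrient n} S∈𝒟)) , free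
    signatures-unique : Unique (map signature L)
    signatures-unique = map-unique signature
      (λ S∈ S'∈ → signature-injective (proj₁ (member S∈)) (proj₁ (member S'∈)))
      (filter⁺ (λ S → K3cyc-free? (S ∪ₒ T)) (filter⁺ (λ M → isOrientation? cross M ×-dec K3cyc-free? M) (allOrient-unique n)))
    signatures-admissible : map signature L ⊆ filterᵇ (Admissible neighbourhood (edgePattern T)) (allVecs bools 4)
    signatures-admissible k∈ with ∈-map⁻ signature k∈
    ... | S , S∈L , refl = ∈-filter⁺ (λ k → T? (Admissible neighbourhood (edgePattern T) k))
                             (allVecs-complete bools-complete (signature S))
                             (Equivalence.from T-≡ (signature-admissible S T (proj₁ (member S∈L)) OT (proj₂ (member S∈L))))

-- ext is a maximum over T ∈ 𝒟(G[{u}] ∪ G[B]) of counts each bounded by 5.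
lemma2p7 : ∀ {n} (G : Graph n) (u : Fin n) (B : Subset n) → K4-free G
    → u ∉ B → ∣ B ∣ ≡ 4 → InducesK4⁻ G B → ext G ⁅ u ⁆ B ≤ 5
lemma2p7 G u B k4 u∉B _ (a , b , c , d , _ , _ , _ , _ , _ , _ , B⊆abcd , Ba , Bb , Bc , Bd , ab , ac , ad , bc , bd , _) =
  foldr-preservesᵇ {P = _≤ 5} ⊔-lub z≤n (AllP.map⁺ {f = compatibleCount} (All.tabulate (compatible-bound k4)))
  where
  u∉Bᵇ : lookup B u ≡ false
  u∉Bᵇ with lookup B u in Bu
  ... | true  = ⊥-elim (u∉B (lookup⇒[]= u B Bu))
  ... | false = refl
  open AtVertex G u B u∉Bᵇ a b c d B⊆abcd Ba Bb Bc Bd ab ac ad bc bd
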